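{- Let $(M, S_{1}, S_{2}, \ldots, \partial)$ be a model of ${\tt \Delta^{1}_{1}\text{ - }BL}_{0}$. Then there is an injective non-surjective function $s:M\rightarrow M$ with $\mathrm{graph}(s)\in S_{2}$ and $s(x)=\partial(\{x\})$ for all $x\in M$.
   Context: Structures $(M,S_1,S_2,\ldots,\partial)$ are many-sorted: objects $M$, $n$-ary relations $S_n\subseteq P(M^n)$ (elements of $S_1$ are sets), and $\partial:S_1\to M$. Basic Law V: $\partial X=\partial Y\leftrightarrow X=Y$. Arithmetical formulas have no bound relation variables (may contain $\partial$); $\Sigma^1_1$ ($\Pi^1_1$) formulas are arithmetical formulas preceded by a block of existential (universal) relation quantifiers of any arities. ${\tt \Delta^1_1\text{ - }BL}_0$: Basic Law V plus $[\forall\bar n(\varphi(\bar n)\leftrightarrow\psi(\bar n))]\to\exists R\forall\bar n[\bar n\in R\leftrightarrow\varphi(\bar n)]$ for $\Sigma^1_1$ $\varphi$, $\Pi^1_1$ $\psi$ (parameters allowed). -}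

module Defs where

open import Data.Nat using (ℕ; zero; suc; _+_)
open import Data.Fin using (Fin)
open import Data.Vec using (Vec; []; _∷_; lookup; _++_; map)
open import Data.List using (List; []; _∷_)
open import Data.Product using (Σ; _×_; _,_)
open import Data.Sum using (_⊎_)
open import Data.Empty using (⊥)
open import Relation.Nullary using (¬_)
open import Relation.Binary.PropositionalEquality using (_≡_)
open import Function.Bundles using (_⇔_)

-- Arity convention: `Rel a` is the sort S_{a+1} (so arities are ≥ 1);
-- an element R : Rel a has extension {v ∈ M^{a+1} | v ∈ᴿ R}.
-- Since S_n ⊆ P(M^n), elements of a sort are determined by their
-- extension (field `ext`).

record Structure : Set₁ where
  field
    M    : Set
    Rel  : ℕ → Set
    _∈ᴿ_ : ∀ {a} → Vec M (suc a) → Rel a → Set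
    ext  : ∀ {a} (R R′ : Rel a) →
           (∀ v → (v ∈ᴿ R) ⇔ (v ∈ᴿ R′)) → R ≡ R′
    ∂    : Rel 0 → M

-- Syntax.  Object variables: de Bruijn indices `Fin m`.
-- Relation variables: de Bruijn indices into a context Γ : List ℕ of
-- arities (again in the "arity − 1" convention).

data RVar : List ℕ → ℕ → Set where
  here  : ∀ {Γ a} → RVar (a ∷ Γ) a
  there : ∀ {Γ a b} → RVar Γ a → RVar (b ∷ Γ) a

data Term (m : ℕ) (Γ : List ℕ) : Set where
  var : Fin m → Term m Γ
  ∂t  : RVar Γ 0 → Term m Γ

-- arithmetical formulas (no bound relation variables; may contain ∂)
data Form (m : ℕ) (Γ : List ℕ) : Set where
  _≐_  : Term m Γ → Term m Γ → Form m Γ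
  _∈f_ : ∀ {a} → Vec (Term m Γ) (suc a) → RVar Γ a → Form m Γ
  ⊥f   : Form m Γ
  ¬f_  : Form m Γ → Form m Γ
  _∧f_ : Form m Γ → Form m Γ → Form m Γ
  _∨f_ : Form m Γ → Form m Γ → Form m Γ
  _⇒f_ : Form m Γ → Form m Γ → Form m Γ
  ∀f   : Form (suc m) Γ → Form m Γ
  ∃f   : Form (suc m) Γ → Form m Γ

data Σ¹₁ (m : ℕ) (Γ : List ℕ) : Set where
  arith : Form m Γ → Σ¹₁ m Γ
  ∃R    : (a : ℕ) → Σ¹₁ m (a ∷ Γ) → Σ¹₁ m Γ

data Π¹₁ (m : ℕ) (Γ : List ℕ) : Set where
  arith : Form m Γ → Π¹₁ m Γ
  ∀R    : (a : ℕ) → Π¹₁ m (a ∷ Γ) → Π¹₁ m Γ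

module Semantics (𝔐 : Structure) where
  open Structure 𝔐

  REnv : List ℕ → Set
  REnv Γ = ∀ {a} → RVar Γ a → Rel a

  _∷ᴿ_ : ∀ {Γ a} → Rel a → REnv Γ → REnv (a ∷ Γ)
  (R ∷ᴿ σ) here      = R
  (R ∷ᴿ σ) (there x) = σ x

  ⟦_⟧t : ∀ {m Γ} → Term m Γ → Vec M m → REnv Γ → M
  ⟦ var i ⟧t ρ σ = lookup ρ i
  ⟦ ∂t X  ⟧t ρ σ = ∂ (σ X)

  ⟦_⟧f : ∀ {m Γ} → Form m Γ → Vec M m → REnv Γ → Set
  ⟦ t ≐ u    ⟧f ρ σ = ⟦ t ⟧t ρ σ ≡ ⟦ u ⟧t ρ σ
  ⟦ ts ∈f X  ⟧f ρ σ = map (λ t → ⟦ t ⟧t ρ σ) ts ∈ᴿ σ X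
  ⟦ ⊥f       ⟧f ρ σ = ⊥
  ⟦ ¬f φ     ⟧f ρ σ = ¬ ⟦ φ ⟧f ρ σ
  ⟦ φ ∧f ψ   ⟧f ρ σ = ⟦ φ ⟧f ρ σ × ⟦ ψ ⟧f ρ σ
  ⟦ φ ∨f ψ   ⟧f ρ σ = ⟦ φ ⟧f ρ σ ⊎ ⟦ ψ ⟧f ρ σ
  ⟦ φ ⇒f ψ   ⟧f ρ σ = ⟦ φ ⟧f ρ σ → ⟦ ψ ⟧f ρ σ
  ⟦ ∀f φ     ⟧f ρ σ = (x : M) → ⟦ φ ⟧f (x ∷ ρ) σ
  ⟦ ∃f φ     ⟧f ρ σ = Σ M (λ x → ⟦ φ ⟧f (x ∷ ρ) σ)

  ⟦_⟧Σ : ∀ {m Γ} → Σ¹₁ m Γ → Vec M m → REnv Γ → Set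
  ⟦ arith φ ⟧Σ ρ σ = ⟦ φ ⟧f ρ σ
  ⟦ ∃R a φ  ⟧Σ ρ σ = Σ (Rel a) (λ R → ⟦ φ ⟧Σ ρ (R ∷ᴿ σ))

  ⟦_⟧Π : ∀ {m Γ} → Π¹₁ m Γ → Vec M m → REnv Γ → Set
  ⟦ arith φ ⟧Π ρ σ = ⟦ φ ⟧f ρ σ
  ⟦ ∀R a φ  ⟧Π ρ σ = (R : Rel a) → ⟦ φ ⟧Π ρ (R ∷ᴿ σ)

BasicLawV : Structure → Set
BasicLawV 𝔐 = ∀ (X Y : Rel 0) → (∂ X ≡ ∂ Y) ⇔ (X ≡ Y)
  where open Structure 𝔐

-- Δ¹₁-comprehension: for Σ¹₁ φ(n̄, p̄, P̄) and Π¹₁ ψ(n̄, p̄, P̄), where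
-- n̄ is a tuple of a+1 object variables (the first a+1 de Bruijn
-- indices) and p̄ (m object parameters), P̄ (relation parameters Γ) are
-- arbitrary parameters:
--   ∀n̄(φ ↔ ψ) → ∃R ∀n̄ (n̄ ∈ R ↔ φ).
Δ¹₁-CA : Structure → Set
Δ¹₁-CA 𝔐 =
  ∀ (a m : ℕ) (Γ : List ℕ)
    (φ : Σ¹₁ (suc a + m) Γ) (ψ : Π¹₁ (suc a + m) Γ)
    (ρ : Vec M m) (σ : REnv Γ) →
    (∀ (n̄ : Vec M (suc a)) → ⟦ φ ⟧Σ (n̄ ++ ρ) σ ⇔ ⟦ ψ ⟧Π (n̄ ++ ρ) σ) →
    Σ (Rel a) (λ R → ∀ (n̄ : Vec M (suc a)) → (n̄ ∈ᴿ R) ⇔ ⟦ φ ⟧Σ (n̄ ++ ρ) σ)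
  where open Structure 𝔐
        open Semantics 𝔐

record IsModelΔ¹₁-BL₀ (𝔐 : Structure) : Set where
  field
    basicLawV : BasicLawV 𝔐
    Δ¹₁-comprehension : Δ¹₁-CA 𝔐

-- Put s x := ∂{x}.  Singletons exist by arithmetical comprehension, and s is
-- injective by Basic Law V.  The graph of s is Δ¹₁: "y = ∂{x}" is both
-- ∃X (X = {x} ∧ ∂X = y) and ∀X (X = {x} → ∂X = y).  Finally ∂ (let alone s)
-- is not surjective: if it were, the Π¹₁ formula ∀X (∂X = y → y ∉ X) would be
-- equivalent, by Basic Law V, to the Σ¹₁ formula ∃X (∂X = y ∧ y ∉ X), so the
-- Russell set R of all such y would exist, and ∂R ∈ R ↔ ∂R ∉ R.
module Submission where

open import Defs
open import Data.Nat using (suc; _+_)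
open import Data.Fin using (zero; suc)
open import Data.List using ([]; _∷_)
open import Data.Vec using (Vec; []; _∷_; _++_)
open import Data.Product using (Σ; _×_; _,_; proj₁; proj₂)
open import Relation.Nullary using (¬_)
open import Relation.Binary.PropositionalEquality using (_≡_; refl; sym; trans; cong; subst)
open import Function.Bundles using (_⇔_; mk⇔; Equivalence)
open import Function.Construct.Identity using (⇔-id)
open import Function.Construct.Symmetry using (⇔-sym)
open import Function.Construct.Composition using (_⇔-∘_)

open Equivalence using (to; from)

infixr 4 _⇔f_
_⇔f_ : ∀ {m Γ} → Form m Γ → Form m Γ → Form m Γ
φ ⇔f ψ = (φ ⇒f ψ) ∧f (ψ ⇒f φ)

-- "here = {x₀}", where x₀ is the innermost object variable
isSingletonᶠ : ∀ {m Γ} → Form (suc m) (0 ∷ Γ)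
isSingletonᶠ = ∀f (((var zero ∷ []) ∈f here) ⇔f (var zero ≐ var (suc zero)))

module ModelTheory (𝔐 : Structure) (model : IsModelΔ¹₁-BL₀ 𝔐) where
  open Structure 𝔐
  open Semantics 𝔐
  open IsModelΔ¹₁-BL₀ model

  noParameters : REnv []
  noParameters ()

  ∂-injective : ∀ {X Y} → ∂ X ≡ ∂ Y → X ≡ Y
  ∂-injective {X} {Y} = to (basicLawV X Y)

  Δ¹₁-definable : ∀ {a m Γ} (φ : Σ¹₁ (suc a + m) Γ) (ψ : Π¹₁ (suc a + m) Γ)
                  (ρ : Vec M m) (σ : REnv Γ) (P : Vec M (suc a) → Set) →
                  (∀ n̄ → ⟦ φ ⟧Σ (n̄ ++ ρ) σ ⇔ P n̄) →
                  (∀ n̄ → ⟦ ψ ⟧Π (n̄ ++ ρ) σ ⇔ P n̄) →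
                  Σ (Rel a) (λ R → ∀ n̄ → (n̄ ∈ᴿ R) ⇔ P n̄)
  Δ¹₁-definable {a} {m} {Γ} φ ψ ρ σ P φ⇔P ψ⇔P
    with Δ¹₁-comprehension a m Γ φ ψ ρ σ (λ n̄ → ⇔-sym (ψ⇔P n̄) ⇔-∘ φ⇔P n̄)
  ... | R , R⇔φ = R , λ n̄ → φ⇔P n̄ ⇔-∘ R⇔φ n̄

  arithmetical-comprehension : ∀ {a m Γ} (φ : Form (suc a + m) Γ) (ρ : Vec M m) (σ : REnv Γ) →
                               Σ (Rel a) (λ R → ∀ n̄ → (n̄ ∈ᴿ R) ⇔ ⟦ φ ⟧f (n̄ ++ ρ) σ)
  arithmetical-comprehension φ ρ σ =
    Δ¹₁-definable (arith φ) (arith φ) ρ σ (λ n̄ → ⟦ φ ⟧f (n̄ ++ ρ) σ) (λ _ → ⇔-id _) (λ _ → ⇔-id _)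

  IsSingleton : Rel 0 → M → Set
  IsSingleton X x = ∀ z → ((z ∷ []) ∈ᴿ X) ⇔ (z ≡ x)

  isSingletonᶠ⇔IsSingleton : ∀ {m Γ} (ρ : Vec M m) (σ : REnv Γ) {x X} →
                             ⟦ isSingletonᶠ ⟧f (x ∷ ρ) (X ∷ᴿ σ) ⇔ IsSingleton X x
  isSingletonᶠ⇔IsSingleton ρ σ = mk⇔ (λ h z → mk⇔ (proj₁ (h z)) (proj₂ (h z)))
                                     (λ h z → to (h z) , from (h z))

  isSingleton-unique : ∀ {X Y x} → IsSingleton X x → IsSingleton Y x → X ≡ Y
  isSingleton-unique {X} {Y} X≐x Y≐x =
    ext X Y λ { (z ∷ []) → ⇔-sym (Y≐x z) ⇔-∘ X≐x z }

  singleton : M → Rel 0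
  singleton x = proj₁ (arithmetical-comprehension (var zero ≐ var (suc zero)) (x ∷ []) noParameters)

  singleton-isSingleton : ∀ x → IsSingleton (singleton x) x
  singleton-isSingleton x z =
    proj₂ (arithmetical-comprehension (var zero ≐ var (suc zero)) (x ∷ []) noParameters) (z ∷ [])

  singleton-injective : ∀ {x y} → singleton x ≡ singleton y → x ≡ y
  singleton-injective {x} {y} x̂≡ŷ =
    to (singleton-isSingleton y x)
       (subst (λ X → (x ∷ []) ∈ᴿ X) x̂≡ŷ (from (singleton-isSingleton x x) refl))

  s : M → M
  s x = ∂ (singleton x)

  s-injective : ∀ x y → s x ≡ s y → x ≡ y
  s-injective x y sx≡sy = singleton-injective (∂-injective sx≡sy)

  IsSingleton⇒∂≡s : ∀ {X x} → IsSingleton X x → ∂ X ≡ s x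
  IsSingleton⇒∂≡s {x = x} X≐x = cong ∂ (isSingleton-unique X≐x (singleton-isSingleton x))

  graphΣ : Σ¹₁ (2 + 0) []
  graphΣ = ∃R 0 (arith (isSingletonᶠ ∧f (∂t here ≐ var (suc zero))))

  graphΠ : Π¹₁ (2 + 0) []
  graphΠ = ∀R 0 (arith (isSingletonᶠ ⇒f (∂t here ≐ var (suc zero))))

  module _ (x y : M) where
    isSingletonᶠ⇔IsSingleton-at : ∀ {X} →
      ⟦ isSingletonᶠ ⟧f (x ∷ y ∷ []) (X ∷ᴿ noParameters) ⇔ IsSingleton X x
    isSingletonᶠ⇔IsSingleton-at = isSingletonᶠ⇔IsSingleton (y ∷ []) noParameters

    graphΣ⇔s : ⟦ graphΣ ⟧Σ (x ∷ y ∷ []) noParameters ⇔ (s x ≡ y)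
    graphΣ⇔s = mk⇔
      (λ { (X , X≐x , ∂X≡y) →
             trans (sym (IsSingleton⇒∂≡s (to isSingletonᶠ⇔IsSingleton-at X≐x))) ∂X≡y })
      (λ sx≡y → singleton x , from isSingletonᶠ⇔IsSingleton-at (singleton-isSingleton x) , sx≡y)

    graphΠ⇔s : ⟦ graphΠ ⟧Π (x ∷ y ∷ []) noParameters ⇔ (s x ≡ y)
    graphΠ⇔s = mk⇔
      (λ h → h (singleton x) (from isSingletonᶠ⇔IsSingleton-at (singleton-isSingleton x)))
      (λ sx≡y X X≐x → trans (IsSingleton⇒∂≡s (to isSingletonᶠ⇔IsSingleton-at X≐x)) sx≡y)

  graph : Σ (Rel 1) (λ G → ∀ x y → ((x ∷ y ∷ []) ∈ᴿ G) ⇔ (s x ≡ y))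
  graph with Δ¹₁-definable graphΣ graphΠ [] noParameters (λ { (x ∷ y ∷ []) → s x ≡ y })
               (λ { (x ∷ y ∷ []) → graphΣ⇔s x y })
               (λ { (x ∷ y ∷ []) → graphΠ⇔s x y })
  ... | G , G-member = G , λ x y → G-member (x ∷ y ∷ [])

  Russell : M → Set
  Russell y = Σ (Rel 0) (λ X → ∂ X ≡ y × ¬ ((y ∷ []) ∈ᴿ X))

  no-Russell-set : ¬ Σ (Rel 0) (λ R → ∀ y → ((y ∷ []) ∈ᴿ R) ⇔ Russell y)
  no-Russell-set (R , R-member) = ∂R∉R (from (R-member (∂ R)) (R , refl , ∂R∉R))
    where
    ∂R∉R : ¬ ((∂ R ∷ []) ∈ᴿ R)
    ∂R∉R ∂R∈R with to (R-member (∂ R)) ∂R∈R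
    ... | X , ∂X≡∂R , ∂R∉X = ∂R∉X (subst (λ Y → (∂ R ∷ []) ∈ᴿ Y) (sym (∂-injective ∂X≡∂R)) ∂R∈R)

  russellΣ : Σ¹₁ (1 + 0) []
  russellΣ = ∃R 0 (arith ((∂t here ≐ var zero) ∧f (¬f ((var zero ∷ []) ∈f here))))

  russellΠ : Π¹₁ (1 + 0) []
  russellΠ = ∀R 0 (arith ((∂t here ≐ var zero) ⇒f (¬f ((var zero ∷ []) ∈f here))))

  russellΠ⇔Russell : (∀ y → Σ (Rel 0) (λ X → ∂ X ≡ y)) →
                     ∀ y → ⟦ russellΠ ⟧Π (y ∷ []) noParameters ⇔ Russell y
  russellΠ⇔Russell ∂-surjective y = mk⇔
    (λ h → let X , ∂X≡y = ∂-surjective y in X , ∂X≡y , h X ∂X≡y)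
    (λ { (X , ∂X≡y , y∉X) Y ∂Y≡y y∈Y →
           y∉X (subst (λ Z → (y ∷ []) ∈ᴿ Z) (∂-injective (trans ∂Y≡y (sym ∂X≡y))) y∈Y) })

  ∂-not-surjective : ¬ (∀ y → Σ (Rel 0) (λ X → ∂ X ≡ y))
  ∂-not-surjective ∂-surjective
    with Δ¹₁-definable russellΣ russellΠ [] noParameters (λ { (y ∷ []) → Russell y })
           (λ { (y ∷ []) → ⇔-id _ }) (λ { (y ∷ []) → russellΠ⇔Russell ∂-surjective y })
  ... | R , R-member = no-Russell-set (R , λ y → R-member (y ∷ []))

  s-not-surjective : ¬ (∀ y → Σ M (λ x → s x ≡ y))
  s-not-surjective s-surjective =
    ∂-not-surjective λ y → let x , sx≡y = s-surjective y in singleton x , sx≡y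

corollary3p7 : (𝔐 : Structure) → IsModelΔ¹₁-BL₀ 𝔐 →
    let open Structure 𝔐 in
    Σ (M → M) (λ s →
      (∀ x y → s x ≡ s y → x ≡ y)
      × ¬ (∀ y → Σ M (λ x → s x ≡ y))
      × Σ (Rel 1) (λ G → ∀ x y → ((x ∷ y ∷ []) ∈ᴿ G) ⇔ (s x ≡ y))
      × (∀ x → Σ (Rel 0) (λ X →
            (∀ z → ((z ∷ []) ∈ᴿ X) ⇔ (z ≡ x)) × (s x ≡ ∂ X))))
corollary3p7 𝔐 model =
  s , s-injective , s-not-surjective , graph , λ x → singleton x , singleton-isSingleton x , refl
  where open ModelTheory 𝔐 model
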